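{- Fix an integer $n\geq2$. For any positive integer $k$ satisfying $k+2^k-1\leq n$ and any prime number $p$ satisfying $n-2^k+1\leq p\leq (n-k-2^k+3)2^k-3$, there is an arithmetical structure on $K_n$ with $r_1=p$.
   Context: An arithmetical structure on the complete graph $K_n$ (with $n$ vertices) is a collection of positive integers $r_1,r_2,\dotsc,r_n$ with $\gcd(r_1,\dotsc,r_n)=1$ such that $r_j$ divides $\sum_{i=1}^n r_i$ for every $j$. The values are ordered so that $r_1\geq r_2\geq\dotsb\geq r_n$; thus $r_1$ is the largest value of the structure. -}

module Defs where

open import Data.Nat using (ℕ; zero; suc; _+_; _≤_; _<_)
open import Data.Nat.Divisibility using (_∣_)
open import Data.Nat.GCD using (gcd)
open import Data.Fin using (Fin; _≤_)
open import Data.List using (foldr)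
open import Data.Vec.Functional using (Vector; toList)
open import Data.Product using (_×_)
open import Relation.Binary.PropositionalEquality using (_≡_)

vsum : ∀ {n} → Vector ℕ n → ℕ
vsum r = foldr _+_ 0 (toList r)

-- gcd(r_1,...,r_n)  (gcd of the empty family is 0)
vgcd : ∀ {n} → Vector ℕ n → ℕ
vgcd r = foldr gcd 0 (toList r)

-- An arithmetical structure on K_n, with entries r_1 ≥ r_2 ≥ ... ≥ r_n
-- (index i : Fin n corresponds to r_{i+1}).
record ArithStructK (n : ℕ) (r : Vector ℕ n) : Set where
  field
    positive : ∀ i → 0 < r i
    coprime  : vgcd r ≡ 1
    divides  : ∀ j → r j ∣ vsum r
    ordered  : ∀ i j → i Data.Fin.≤ j → r j Data.Nat.≤ r i

{-# OPTIONS --safe #-}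
module Submission where

-- Write n = (2^k ∸ 1) + (k + d). The bounds on p guarantee that p is a sum of exactly k + d
-- powers of two, each dividing 2^k: the binary expansion (with extra copies of 2^k) uses few
-- enough parts, and halving a part adds one. Together with 2^k ∸ 1 copies of p these parts sum
-- to 2^k p, so every entry divides the sum. A common divisor of all entries divides p, and it
-- cannot be p itself, because p cannot divide two positive parts that add up to at most p.

open import Defs
open import Data.Nat
  using (ℕ; zero; suc; _+_; _*_; _∸_; _^_; _≤_; _<_; _≤′_; ≤′-refl; ≤′-step; z≤n; s≤s; z<s; _<?_;
         >-nonZero⁻¹; nonTrivial⇒n>1)
open import Data.Nat.Properties
open import Data.Nat.Divisibility using (_∣_; ∣-trans; ∣⇒≤; m∣m*n; n∣m*n)
open import Data.Nat.GCD using (gcd; gcd[m,n]∣m; gcd[m,n]∣n)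
open import Data.Nat.ListAction using (sum)
open import Data.Nat.ListAction.Properties using (sum-++; sum-↭)
open import Data.Nat.Primality using (Prime; prime⇒irreducible; prime⇒nonZero; prime⇒nonTrivial)
open import Data.Nat.Tactic.RingSolver using (solve-∀)
open import Data.Fin using (Fin)
open import Data.Vec.Functional using (Vector)
open import Data.List using (List; []; _∷_; _++_; replicate; length; foldr; lookup)
open import Data.List.Properties using (tabulate-lookup; length-++; length-replicate)
open import Data.List.Membership.Propositional using (_∈_)
open import Data.List.Membership.Propositional.Properties using (∈-lookup)
open import Data.List.Relation.Unary.All as All using (All; []; _∷_)
open import Data.List.Relation.Unary.All.Properties using (++⁺; ++⁻ʳ; replicate⁺)
open import Data.List.Relation.Unary.Any using (here; index)
open import Data.List.Relation.Unary.Any.Properties using (lookup-index)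
open import Data.List.Relation.Unary.Sorted.TotalOrder.Properties using (lookup-mono-≤)
open import Data.List.Relation.Binary.Permutation.Propositional using (↭-sym)
open import Data.List.Relation.Binary.Permutation.Propositional.Properties
  using (All-resp-↭; ∈-resp-↭; ↭-length)
import Data.List.Sort as Sort
import Relation.Binary.Construct.Flip.EqAndOrd as Flip
open import Data.Product using (Σ; ∃; _×_; _,_)
open import Data.Sum using (inj₁; inj₂)
open import Relation.Nullary using (yes; no; ¬_; contradiction)
open import Relation.Binary.PropositionalEquality
  using (_≡_; _≢_; refl; sym; trans; cong; cong₂; subst; module ≡-Reasoning)

m^n∣m^o : ∀ m {n o} → n ≤ o → m ^ n ∣ m ^ o
m^n∣m^o m {n} {o} n≤o = subst (m ^ n ∣_) m^n*m^[o∸n]≡m^o (m∣m*n (m ^ (o ∸ n)))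
  where
  m^n*m^[o∸n]≡m^o : m ^ n * m ^ (o ∸ n) ≡ m ^ o
  m^n*m^[o∸n]≡m^o = trans (sym (^-distribˡ-+-* m n (o ∸ n))) (cong (m ^_) (m+[n∸m]≡n n≤o))

2^[1+n]≡2^n+2^n : ∀ n → 2 ^ suc n ≡ 2 ^ n + 2 ^ n
2^[1+n]≡2^n+2^n n = cong (2 ^ n +_) (+-identityʳ (2 ^ n))

0<m≤o∸n⇒m+n≤o : ∀ {m n o} → 0 < m → m ≤ o ∸ n → m + n ≤ o
0<m≤o∸n⇒m+n≤o {m} {n} {o} 0<m m≤o∸n = m≤o∸n⇒m+n≤o m (<⇒≤ (m∸n≢0⇒n<m o∸n≢0)) m≤o∸n
  where
  o∸n≢0 : o ∸ n ≢ 0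
  o∸n≢0 o∸n≡0 = <⇒≱ 0<m (subst (m ≤_) o∸n≡0 m≤o∸n)

sum-replicate : ∀ n x → sum (replicate n x) ≡ n * x
sum-replicate zero    x = refl
sum-replicate (suc n) x = cong (x +_) (sum-replicate n x)

all-≤-sum : ∀ xs → All (_≤ sum xs) xs
all-≤-sum []       = []
all-≤-sum (x ∷ xs) =
  m≤m+n x (sum xs) ∷ All.map (λ y≤sum → ≤-trans y≤sum (m≤n+m (sum xs) x)) (all-≤-sum xs)

foldr-gcd-∣ : ∀ xs → All (foldr gcd 0 xs ∣_) xs
foldr-gcd-∣ []       = []
foldr-gcd-∣ (x ∷ xs) =
  gcd[m,n]∣m x (foldr gcd 0 xs) ∷ All.map (∣-trans (gcd[m,n]∣n x (foldr gcd 0 xs))) (foldr-gcd-∣ xs)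

data Partition (k : ℕ) : ℕ → Set where
  []  : Partition k 0
  _∷_ : ∀ {e p} → e ≤ k → Partition k p → Partition k (2 ^ e + p)

size : ∀ {k p} → Partition k p → ℕ
size []      = 0
size (_ ∷ P) = suc (size P)

parts : ∀ {k p} → Partition k p → List ℕ
parts []            = []
parts (_∷_ {e} _ P) = 2 ^ e ∷ parts P

sum-parts : ∀ {k p} (P : Partition k p) → sum (parts P) ≡ p
sum-parts []            = refl
sum-parts (_∷_ {e} _ P) = cong (2 ^ e +_) (sum-parts P)

length-parts : ∀ {k p} (P : Partition k p) → length (parts P) ≡ size P
length-parts []      = refl
length-parts (_ ∷ P) = cong suc (length-parts P)

parts-positive : ∀ {k p} (P : Partition k p) → All (0 <_) (parts P)
parts-positive []            = []
parts-positive (_∷_ {e} _ P) = m^n>0 2 e ∷ parts-positive P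

parts-∣ : ∀ {k p} (P : Partition k p) → All (_∣ 2 ^ k) (parts P)
parts-∣ []        = []
parts-∣ (e≤k ∷ P) = m^n∣m^o 2 e≤k ∷ parts-∣ P

¬sum∣parts : ∀ {k p} (P : Partition k p) → 2 ≤ size P → ¬ All (p ∣_) (parts P)
¬sum∣parts (_ ∷ []) (s≤s ())
¬sum∣parts (_∷_ {e} _ (_∷_ {e′} _ _)) _ (p∣2^e ∷ _) =
  <⇒≱ (m<m+n (2 ^ e) (<-≤-trans (m^n>0 2 e′) (m≤m+n _ _))) (∣⇒≤ {{m^n≢0 2 e}} p∣2^e)

split-part : ∀ {k p} (P : Partition k p) → size P < p →
             Σ (Partition k p) λ Q → size Q ≡ suc (size P)
split-part [] ()
split-part (_∷_ {zero} e≤k P) (s≤s size<p)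
  with Q , size≡ ← split-part P size<p = e≤k ∷ Q , cong suc size≡
split-part {k} (_∷_ {suc e} {p} e<k P) _ = subst (Partition k) halves Q , size-subst halves Q
  where
  e≤k = <⇒≤ e<k
  Q = e≤k ∷ (e≤k ∷ P)
  halves : 2 ^ e + (2 ^ e + p) ≡ 2 ^ suc e + p
  halves = trans (sym (+-assoc (2 ^ e) (2 ^ e) p)) (cong (_+ p) (sym (2^[1+n]≡2^n+2^n e)))
  size-subst : ∀ {q r} (eq : q ≡ r) (R : Partition k q) → size (subst (Partition k) eq R) ≡ size R
  size-subst refl R = refl

partition-of-size : ∀ {k p} (P : Partition k p) {c} → size P ≤′ c → c ≤ p →
                    Σ (Partition k p) λ Q → size Q ≡ c
partition-of-size P ≤′-refl _ = P , refl
partition-of-size {p = p} P (≤′-step size≤′c) c<p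
  with Q , size≡c ← partition-of-size P size≤′c (<⇒≤ c<p)
  with R , size≡ ← split-part Q (subst (_< p) (sym size≡c) c<p)
  = R , trans size≡ (cong suc size≡c)

binary-partition : ∀ {K} k p → k ≤ K → p < 2 ^ k → Σ (Partition K p) λ P → size P ≤ k
binary-partition zero    zero    _ _        = [] , z≤n
binary-partition zero    (suc p) _ (s≤s ())
binary-partition (suc k) p k<K p<2^[1+k] with p <? 2 ^ k
... | yes p<2^k
  with P , size≤k ← binary-partition k p (<⇒≤ k<K) p<2^k = P , m≤n⇒m≤1+n size≤k
... | no p≮2^k with s , refl ← m≤n⇒∃[o]m+o≡n (≮⇒≥ p≮2^k)
  with P , size≤k ← binary-partition k s (<⇒≤ k<K)
                      (+-cancelˡ-< (2 ^ k) s (2 ^ k) (subst (2 ^ k + s <_) (2^[1+n]≡2^n+2^n k) p<2^[1+k]))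
  = <⇒≤ k<K ∷ P , s≤s size≤k

short-partition : ∀ {K} k e p → k ≤ K → p + 2 ≤ suc e * 2 ^ k → Σ (Partition K p) λ P → size P < k + e
short-partition zero    zero p _ p+2≤1 = contradiction (m+n≤o⇒n≤o p p+2≤1) λ { (s≤s ()) }
short-partition (suc k) zero p k<K p+2≤2^[1+k]
  with P , size<k+1 ← short-partition k 1 p (<⇒≤ k<K) (subst (p + 2 ≤_) (+-identityʳ _) p+2≤2^[1+k])
  = P , subst (size P <_) (trans (+-comm k 1) (sym (+-identityʳ (suc k)))) size<k+1
short-partition k (suc e) p k≤K p+2≤[2+e]*2^k with p <? 2 ^ k
... | yes p<2^k
  with P , size≤k ← binary-partition k p k≤K p<2^k = P , ≤-<-trans size≤k (m<m+n k z<s)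
... | no p≮2^k with s , refl ← m≤n⇒∃[o]m+o≡n (≮⇒≥ p≮2^k)
  with P , size<k+e ← short-partition k e s k≤K
                        (+-cancelˡ-≤ (2 ^ k) _ _
                          (subst (_≤ 2 ^ k + suc e * 2 ^ k) (+-assoc (2 ^ k) s 2) p+2≤[2+e]*2^k))
  = k≤K ∷ P , ≤-trans (s≤s size<k+e) (≤-reflexive (sym (+-suc k e)))

StructureWithLargest : ℕ → ℕ → Set
StructureWithLargest n p =
  Σ (Vector ℕ n) (λ r → ArithStructK n r × (∃ λ (i : Fin n) → r i ≡ p) × (∀ j → r j ≤ p))

open Sort (Flip.decTotalOrder ≤-decTotalOrder) using (sort; sort-↭; sort-↗)

structure-of-list : ∀ p xs → All (0 <_) xs → All (_∣ sum xs) xs →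
                    (∀ {g} → All (g ∣_) xs → g ≡ 1) → p ∈ xs → All (_≤ p) xs → StructureWithLargest (length xs) p
structure-of-list p xs positive divides coprime p∈xs ≤p =
  subst (λ n → StructureWithLargest n p) (↭-length ys↭xs)
    (lookup ys , structure , (index p∈ys , sym (lookup-index p∈ys)) , λ j → at j (All-resp-↭ xs↭ys ≤p))
  where
  ys = sort xs
  ys↭xs = sort-↭ xs
  xs↭ys = ↭-sym ys↭xs
  p∈ys = ∈-resp-↭ xs↭ys p∈xs
  at : ∀ {P : ℕ → Set} i → All P ys → P (lookup ys i)
  at i Pys = All.lookup Pys (∈-lookup i)
  sum-ys : sum ys ≡ sum xs
  sum-ys = sum-↭ ys↭xs
  structure : ArithStructK (length ys) (lookup ys)
  structure = record
    { positive = λ i → at i (All-resp-↭ xs↭ys positive)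
    ; coprime  = trans (cong (foldr gcd 0) (tabulate-lookup ys))
                       (coprime (All-resp-↭ ys↭xs (foldr-gcd-∣ ys)))
    ; divides  = λ j → subst (lookup ys j ∣_) (sym (trans (cong sum (tabulate-lookup ys)) sum-ys))
                             (at j (All-resp-↭ xs↭ys divides))
    ; ordered  = λ i j → lookup-mono-≤ (Flip.totalOrder ≤-totalOrder) (sort-↗ xs)
    }

structure-of-partition : ∀ {k p} m → suc (suc m) ≡ 2 ^ k → Prime p → (P : Partition k p) → 2 ≤ size P →
                         StructureWithLargest (suc m + size P) p
structure-of-partition {k} {p} m 2+m≡2^k p-prime P 2≤size =
  subst (λ n → StructureWithLargest n p) length-xs
    (structure-of-list p xs positive divides coprime (here refl) ≤p)
  where
  copies = replicate (suc m) p
  xs = copies ++ parts P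
  length-xs : length xs ≡ suc m + size P
  length-xs = trans (length-++ copies) (cong₂ _+_ (length-replicate (suc m)) (length-parts P))
  sum-xs : sum xs ≡ 2 ^ k * p
  sum-xs = begin
    sum xs                     ≡⟨ sum-++ copies (parts P) ⟩
    sum copies + sum (parts P) ≡⟨ cong₂ _+_ (sum-replicate (suc m) p) (sum-parts P) ⟩
    suc m * p + p              ≡⟨ +-comm (suc m * p) p ⟩
    suc (suc m) * p            ≡⟨ cong (_* p) 2+m≡2^k ⟩
    2 ^ k * p                  ∎
    where open ≡-Reasoning
  positive : All (0 <_) xs
  positive = ++⁺ (replicate⁺ (suc m) (>-nonZero⁻¹ p {{prime⇒nonZero p-prime}})) (parts-positive P)
  divides : All (_∣ sum xs) xs
  divides = subst (λ s → All (_∣ s) xs) (sym sum-xs)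
    (++⁺ (replicate⁺ (suc m) (n∣m*n (2 ^ k)))
         (All.map (λ w∣2^k → ∣-trans w∣2^k (m∣m*n p)) (parts-∣ P)))
  coprime : ∀ {g} → All (g ∣_) xs → g ≡ 1
  coprime g∣xs@(g∣p ∷ _) with prime⇒irreducible p-prime g∣p
  ... | inj₁ g≡1  = g≡1
  ... | inj₂ refl = contradiction (++⁻ʳ copies g∣xs) (¬sum∣parts P 2≤size)
  ≤p : All (_≤ p) xs
  ≤p = ++⁺ (replicate⁺ (suc m) ≤-refl)
           (subst (λ s → All (_≤ s) (parts P)) (sum-parts P) (all-≤-sum (parts P)))

2≤k+d : ∀ {k d p} → 1 ≤ k → 2 ≤ p → p + 3 ≤ (2 + d) * 2 ^ k → 2 ≤ k + d
2≤k+d {suc zero}    {zero}  _ 2≤p p+3≤4 =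
  contradiction (≤-trans (+-monoˡ-≤ 3 2≤p) p+3≤4) λ { (s≤s (s≤s (s≤s (s≤s ())))) }
2≤k+d {suc zero}    {suc d} _ _ _ = s≤s (s≤s z≤n)
2≤k+d {suc (suc k)}         _ _ _ = s≤s (s≤s z≤n)

largest-prime-structure : ∀ k d p → 1 ≤ k → Prime p → k + d ≤ p → p + 3 ≤ (2 + d) * 2 ^ k →
                          StructureWithLargest (2 ^ k ∸ 1 + (k + d)) p
largest-prime-structure k d p 1≤k p-prime k+d≤p p+3≤[2+d]*2^k
  with m , 2+m≡2^k ← m≤n⇒∃[o]m+o≡n (^-monoʳ-≤ 2 1≤k)
  with P₀ , size<k+[1+d] ← short-partition k (suc d) p ≤-refl
                             (≤-trans (+-monoʳ-≤ p (n≤1+n 2)) p+3≤[2+d]*2^k)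
  with P , size≡k+d ← partition-of-size P₀
                        (≤⇒≤′ (≤-pred (subst (size P₀ <_) (+-suc k d) size<k+[1+d]))) k+d≤p
  = subst (λ n → StructureWithLargest n p) (cong₂ _+_ (cong (_∸ 1) 2+m≡2^k) size≡k+d)
      (structure-of-partition m 2+m≡2^k p-prime P (subst (2 ≤_) (sym size≡k+d) 2≤k+d′))
  where
  2≤k+d′ = 2≤k+d 1≤k (nonTrivial⇒n>1 p {{prime⇒nonTrivial p-prime}}) p+3≤[2+d]*2^k

bounds-in-terms-of-d : ∀ {n k K p} → 1 ≤ K → 0 < p →
  k + K ∸ 1 ≤ n → n + 1 ∸ K ≤ p → p ≤ (n + 3 ∸ (k + K)) * K ∸ 3 →
  ∃ λ d → K ∸ 1 + (k + d) ≡ n × k + d ≤ p × p + 3 ≤ (2 + d) * K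
bounds-in-terms-of-d {n} {k} {suc J} {p} (s≤s z≤n) 0<p k+K∸1≤n lo hi
  with d , refl ← m≤n⇒∃[o]m+o≡n (subst (λ x → x ∸ 1 ≤ n) (+-suc k J) k+K∸1≤n)
  = d , length≡ k J d
      , subst (_≤ p) (trans (cong (_∸ suc J) (lower≡ k J d)) (m+n∸n≡m (k + d) (suc J))) lo
      , 0<m≤o∸n⇒m+n≤o 0<p (subst (λ x → p ≤ x * suc J ∸ 3) upper∸≡ hi)
  where
  length≡ : ∀ k J d → J + (k + d) ≡ k + J + d
  length≡ = solve-∀
  lower≡ : ∀ k J d → k + J + d + 1 ≡ k + d + suc J
  lower≡ = solve-∀
  upper≡ : ∀ k J d → k + J + d + 3 ≡ k + suc J + (2 + d)
  upper≡ = solve-∀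
  upper∸≡ : k + J + d + 3 ∸ (k + suc J) ≡ 2 + d
  upper∸≡ = trans (cong (_∸ (k + suc J)) (upper≡ k J d)) (m+n∸m≡n (k + suc J) (2 + d))

proposition2p5 : (n : ℕ) → 2 ≤ n → (k : ℕ) → 1 ≤ k → k + 2 ^ k ∸ 1 ≤ n → (p : ℕ) → Prime p
    → (n + 1) ∸ 2 ^ k ≤ p → p ≤ ((n + 3) ∸ (k + 2 ^ k)) * 2 ^ k ∸ 3
    → Σ (Vector ℕ n) (λ r → ArithStructK n r × (∃ λ (i : Fin n) → r i ≡ p) × (∀ j → r j ≤ p))
-- The hypothesis 2 ≤ n is implied by 1 ≤ k and k + 2 ^ k ∸ 1 ≤ n.
proposition2p5 n _ k 1≤k k+2^k∸1≤n p p-prime lo hi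
  with d , length≡n , k+d≤p , p+3≤[2+d]*2^k
         ← bounds-in-terms-of-d (m^n>0 2 k) (>-nonZero⁻¹ p {{prime⇒nonZero p-prime}}) k+2^k∸1≤n lo hi
  = subst (λ n → StructureWithLargest n p) length≡n
      (largest-prime-structure k d p 1≤k p-prime k+d≤p p+3≤[2+d]*2^k)
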